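{- Let $\psi\in\mathcal{D}$ be a DQBF over $V$ and let $\exists y(D_y):\varphi$ be a subformula of $\psi$ with $y\notin V_\varphi$. Let $\psi'$ result from $\psi$ by replacing the subformula $\exists y(D_y):\varphi$ by $\varphi$. Then $\psi$ and $\psi'$ are equisatisfiable.
   Context: Notation: $\mathcal{F}(W)$ is the set of Boolean functions over variable set $W$; $\mathrm{supp}(f)$ the set of variables $f$ depends on. Syntax (non-closed non-prenex DQBFs in NNF over a finite variable set $V$). The set $\mathcal{D}$, with for each $\psi$ the sets $V^{\exists}_\psi$ (existential), $V^{\forall}_\psi$ (universal), $V^{\mathrm{fs}}_\psi$ (free variables occurring in $\psi$), and a dependency set $D_y\subseteq V$ for each existential $y$, is the smallest set closed under: (1) $v\in\mathcal{D}$ for $v\in V$ ($V^\exists=V^\forall=\emptyset$, $V^{\mathrm{fs}}=\{v\}$); (2) $\neg v\in\mathcal{D}$, same sets; (3),(4) if $\varphi_1,\varphi_2\in\mathcal{D}$ and $\bigl(V^Q_{\varphi_1}\cup V^{\mathrm{fs}}_{\varphi_1}\cup\bigcup_{y\in V^\exists_{\varphi_1}}D_y\bigr)\cap V^Q_{\varphi_2}=\emptyset$ and symmetrically, then $(\varphi_1\wedge\varphi_2),(\varphi_1\vee\varphi_2)\in\mathcal{D}$ with all three sets the unions; (5) if $\varphi\in\mathcal{D}$, $v\in V^{\mathrm{free}}_\varphi$, $D_v\subseteq V\setminus(V^Q_\varphi\cup\{v\})$, then $\exists v(D_v):\varphi^{ -v}\in\mathcal{D}$ ($\varphi^{ -v}$: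 remove $v$ from all dependency sets in $\varphi$), with $V^\exists=V^\exists_\varphi\cup\{v\}$, $V^{\mathrm{fs}}=V^{\mathrm{fs}}_\varphi\setminus\{v\}$; (6) if $\varphi\in\mathcal{D}$, $v\in V^{\mathrm{free}}_\varphi$, then $\forall v:\varphi\in\mathcal{D}$ with $V^\forall=V^\forall_\varphi\cup\{v\}$, $V^{\mathrm{fs}}=V^{\mathrm{fs}}_\varphi\setminus\{v\}$. Here $V^Q_\psi=V^\exists_\psi\cup V^\forall_\psi$, $V_\psi=V^Q_\psi\cup V^{\mathrm{fs}}_\psi$, $V^{\mathrm{free}}_\psi=V\setminus V^Q_\psi$. Semantics. A Skolem function candidate for $\psi$ is a map $s:V^{\mathrm{free}}_\psi\cup V^\exists_\psi\to\mathcal{F}(V^\forall_\psi)$ with $s(v)$ constant for free $v$ and $\mathrm{supp}(s(v))\subseteq D_v\cap V^\forall_\psi$ for existential $v$. $s(\psi)$ replaces each such $v$ by $s(v)$ and deletes quantifiers. $[\![\psi]\!]$ is the set of candidates $s$ with $s(\psi)$ a tautology. $\psi_1\approx\psi_2$ (equisatisfiable) iff $[\![\psi_1]\!]=\emptyset\Leftrightarrow[\![\psi_2]\!]=\emptyset$. -}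

module Defs where

open import Data.Nat using (ℕ)
open import Data.Fin using (Fin; _≟_)
open import Data.Fin.Subset using (Subset; ⁅_⁆; _∈_; _∉_; _⊆_; ∁; _∩_; _∪_; _─_; Empty)
  renaming (⊥ to ∅)
open import Data.Vec using (lookup)
open import Data.Bool using (Bool; true; false; not; _∧_; _∨_; if_then_else_)
open import Data.Product using (Σ; _×_)
open import Relation.Nullary using (¬_; yes; no)
open import Relation.Binary.PropositionalEquality using (_≡_)
open import Function.Bundles using (_⇔_)

-- Variable set V is Fin n.  Raw (not necessarily well-formed) formulas in NNF.
data Form (n : ℕ) : Set where
  pos  : Fin n → Form n
  neg  : Fin n → Form n
  and  : Form n → Form n → Form n
  or   : Form n → Form n → Form n
  ex   : Fin n → Subset n → Form n → Form n   -- ∃ v (D_v) : φ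
  all  : Fin n → Form n → Form n

module _ {n : ℕ} where

  Vex : Form n → Subset n
  Vex (pos v) = ∅
  Vex (neg v) = ∅
  Vex (and φ χ) = Vex φ ∪ Vex χ
  Vex (or φ χ) = Vex φ ∪ Vex χ
  Vex (ex v D φ) = Vex φ ∪ ⁅ v ⁆
  Vex (all v φ) = Vex φ

  Vall : Form n → Subset n
  Vall (pos v) = ∅
  Vall (neg v) = ∅
  Vall (and φ χ) = Vall φ ∪ Vall χ
  Vall (or φ χ) = Vall φ ∪ Vall χ
  Vall (ex v D φ) = Vall φ
  Vall (all v φ) = Vall φ ∪ ⁅ v ⁆

  Vfs : Form n → Subset n
  Vfs (pos v) = ⁅ v ⁆
  Vfs (neg v) = ⁅ v ⁆
  Vfs (and φ χ) = Vfs φ ∪ Vfs χ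
  Vfs (or φ χ) = Vfs φ ∪ Vfs χ
  Vfs (ex v D φ) = Vfs φ ─ ⁅ v ⁆
  Vfs (all v φ) = Vfs φ ─ ⁅ v ⁆

  VQ : Form n → Subset n
  VQ φ = Vex φ ∪ Vall φ

  Vars : Form n → Subset n
  Vars φ = VQ φ ∪ Vfs φ

  Vfree : Form n → Subset n
  Vfree φ = ∁ (VQ φ)

  allDeps : Form n → Subset n
  allDeps (pos v) = ∅
  allDeps (neg v) = ∅
  allDeps (and φ χ) = allDeps φ ∪ allDeps χ
  allDeps (or φ χ) = allDeps φ ∪ allDeps χ
  allDeps (ex v D φ) = D ∪ allDeps φ
  allDeps (all v φ) = allDeps φ

  -- the dependency set D_y of the existential y in φ (∅ if y is not existential in φ;
  -- in well-formed formulas each variable is quantified at most once)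
  deps : Form n → Fin n → Subset n
  deps (pos v) y = ∅
  deps (neg v) y = ∅
  deps (and φ χ) y = deps φ y ∪ deps χ y
  deps (or φ χ) y = deps φ y ∪ deps χ y
  deps (ex v D φ) y with y ≟ v
  ... | yes _ = D
  ... | no _ = deps φ y
  deps (all v φ) y = deps φ y

  removeDep : Fin n → Form n → Form n
  removeDep v (pos w) = pos w
  removeDep v (neg w) = neg w
  removeDep v (and φ χ) = and (removeDep v φ) (removeDep v χ)
  removeDep v (or φ χ) = or (removeDep v φ) (removeDep v χ)
  removeDep v (ex w D φ) = ex w (D ─ ⁅ v ⁆) (removeDep v φ)
  removeDep v (all w φ) = all w (removeDep v φ)

  Compat : Form n → Form n → Set
  Compat φ₁ φ₂ = Empty ((VQ φ₁ ∪ Vfs φ₁ ∪ allDeps φ₁) ∩ VQ φ₂)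

  -- membership in the set 𝒟
  data WF : Form n → Set where
    wf-pos : ∀ v → WF (pos v)
    wf-neg : ∀ v → WF (neg v)
    wf-and : ∀ {φ₁ φ₂} → WF φ₁ → WF φ₂ → Compat φ₁ φ₂ → Compat φ₂ φ₁ → WF (and φ₁ φ₂)
    wf-or  : ∀ {φ₁ φ₂} → WF φ₁ → WF φ₂ → Compat φ₁ φ₂ → Compat φ₂ φ₁ → WF (or φ₁ φ₂)
    wf-ex  : ∀ {φ} v (D : Subset n) → WF φ → v ∈ Vfree φ →
             D ⊆ ∁ (VQ φ ∪ ⁅ v ⁆) → WF (ex v D (removeDep v φ))
    wf-all : ∀ {φ} v → WF φ → v ∈ Vfree φ → WF (all v φ)

  -- Boolean functions are functions of full assignments; support is expressed by invariance.
  Assignment : Set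
  Assignment = Fin n → Bool

  BoolFun : Set
  BoolFun = Assignment → Bool

  SuppIn : BoolFun → Subset n → Set
  SuppIn f S = ∀ (a b : Assignment) → (∀ w → w ∈ S → a w ≡ b w) → f a ≡ f b

  -- Skolem function candidates for ψ (values on universal variables are irrelevant)
  Candidate : Form n → (Fin n → BoolFun) → Set
  Candidate ψ s =
      (∀ v → v ∈ Vfree ψ → SuppIn (s v) ∅)
    × (∀ v → v ∈ Vex ψ → SuppIn (s v) (deps ψ v ∩ Vall ψ))

  evalM : (Fin n → Bool) → Form n → Bool
  evalM ρ (pos v) = ρ v
  evalM ρ (neg v) = not (ρ v)
  evalM ρ (and φ χ) = evalM ρ φ ∧ evalM ρ χ
  evalM ρ (or φ χ) = evalM ρ φ ∨ evalM ρ χ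
  evalM ρ (ex v D φ) = evalM ρ φ
  evalM ρ (all v φ) = evalM ρ φ

  valuation : Form n → (Fin n → BoolFun) → Assignment → Fin n → Bool
  valuation ψ s a v = if lookup (Vall ψ) v then a v else s v a

  InSem : Form n → (Fin n → BoolFun) → Set
  InSem ψ s = Candidate ψ s × (∀ a → evalM (valuation ψ s a) ψ ≡ true)

  SemEmpty : Form n → Set
  SemEmpty ψ = ¬ Σ (Fin n → BoolFun) (InSem ψ)

  Equisat : Form n → Form n → Set
  Equisat ψ₁ ψ₂ = SemEmpty ψ₁ ⇔ SemEmpty ψ₂

  data Ctx : Set where
    hole : Ctx
    andL : Ctx → Form n → Ctx
    andR : Form n → Ctx → Ctx
    orL  : Ctx → Form n → Ctx
    orR  : Form n → Ctx → Ctx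
    exC  : Fin n → Subset n → Ctx → Ctx
    allC : Fin n → Ctx → Ctx

  plug : Ctx → Form n → Form n
  plug hole χ = χ
  plug (andL C φ) χ = and (plug C χ) φ
  plug (andR φ C) χ = and φ (plug C χ)
  plug (orL C φ) χ = or (plug C χ) φ
  plug (orR φ C) χ = or φ (plug C χ)
  plug (exC v D C) χ = ex v D (plug C χ)
  plug (allC v C) χ = all v (plug C χ)

-- Since y is bound at the hole of the well-formed ψ, it is neither bound again nor
-- occurs anywhere in the context; with y ∉ V_φ it does not occur in ψ' at all.  Deleting
-- ∃y changes no universal variable, no other dependency set and not the matrix.  So a
-- Skolem function for ψ', which must be constant on the free variable y, is one for ψ;
-- conversely one for ψ stays one for ψ' after making it constant at y, a value ψ' never
-- reads.
module Submission where

open import Defs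
open import Algebra.Bundles using (CommutativeMonoid)
open import Data.Nat using (ℕ)
open import Data.Fin using (Fin; _≟_)
open import Data.Fin.Subset using (Subset; _∈_; _∉_; _⊆_; _∪_; _∩_; _─_; ⁅_⁆)
  renaming (⊥ to ∅)
open import Data.Fin.Subset.Properties
open import Data.Bool using (Bool; true; false; not; _∧_; _∨_; if_then_else_)
open import Data.Product using (_,_)
open import Data.Sum using (_⊎_; inj₁; inj₂)
open import Data.Empty using (⊥-elim)
open import Data.Vec using (lookup)
open import Function using (_∘_)
open import Function.Bundles using (mk⇔)
open import Relation.Nullary using (yes; no)
open import Relation.Binary.PropositionalEquality
  using (_≡_; _≢_; refl; sym; trans; cong; cong₂; subst; module ≡-Reasoning)

module _ {n : ℕ} where

  open import Algebra.Properties.CommutativeSemigroup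
    (CommutativeMonoid.commutativeSemigroup (∪-commutativeMonoid n))
    using (interchange; xy∙z≈xz∙y)

  private
    variable
      x v : Fin n
      p q : Subset n
      φ χ χ' ψ ψ' : Form n

  ∈-bind⁻ : x ∈ (q ∪ ⁅ v ⁆) ∪ (p ─ ⁅ v ⁆) → x ≡ v ⊎ x ∈ q ∪ p
  ∈-bind⁻ {q = q} {v} {p} h with x∈p∪q⁻ _ _ h
  ... | inj₂ x∈p─v = inj₂ (q⊆p∪q q p (p─q⊆p p ⁅ v ⁆ x∈p─v))
  ... | inj₁ x∈q∪v with x∈p∪q⁻ q _ x∈q∪v
  ...   | inj₁ x∈q = inj₂ (p⊆p∪q p x∈q)
  ...   | inj₂ x∈v = inj₁ (x∈⁅y⁆⇒x≡y v x∈v)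

  ∈-bind⁺ : x ∈ q ∪ p → x ∈ (q ∪ ⁅ v ⁆) ∪ (p ─ ⁅ v ⁆)
  ∈-bind⁺ {x} {q} {p} {v} h with x∈p∪q⁻ q p h | x ≟ v
  ... | inj₁ x∈q | _        = p⊆p∪q _ (p⊆p∪q _ x∈q)
  ... | inj₂ _   | yes refl = p⊆p∪q _ (q⊆p∪q q _ (x∈⁅x⁆ v))
  ... | inj₂ x∈p | no x≢v   = q⊆p∪q _ _ (x∈p∧x≢y⇒x∈p-y x∈p x≢v)

  VQ-and : ∀ (a b : Form n) → VQ (and a b) ≡ VQ a ∪ VQ b
  VQ-and a b = interchange (Vex a) (Vex b) (Vall a) (Vall b)

  VQ-or : ∀ (a b : Form n) → VQ (or a b) ≡ VQ a ∪ VQ b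
  VQ-or a b = interchange (Vex a) (Vex b) (Vall a) (Vall b)

  VQ-ex : ∀ v D (a : Form n) → VQ (ex v D a) ≡ VQ a ∪ ⁅ v ⁆
  VQ-ex v D a = xy∙z≈xz∙y (Vex a) ⁅ v ⁆ (Vall a)

  VQ-all : ∀ v (a : Form n) → VQ (all v a) ≡ VQ a ∪ ⁅ v ⁆
  VQ-all v a = sym (∪-assoc (Vex a) (Vall a) ⁅ v ⁆)

  Vars-and : ∀ (a b : Form n) → Vars (and a b) ≡ Vars a ∪ Vars b
  Vars-and a b = trans (cong (_∪ (Vfs a ∪ Vfs b)) (VQ-and a b))
                       (interchange (VQ a) (VQ b) (Vfs a) (Vfs b))

  Vars-or : ∀ (a b : Form n) → Vars (or a b) ≡ Vars a ∪ Vars b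
  Vars-or a b = trans (cong (_∪ (Vfs a ∪ Vfs b)) (VQ-or a b))
                      (interchange (VQ a) (VQ b) (Vfs a) (Vfs b))

  Vars-ex : ∀ v D (a : Form n) → Vars (ex v D a) ≡ (VQ a ∪ ⁅ v ⁆) ∪ (Vfs a ─ ⁅ v ⁆)
  Vars-ex v D a = cong (_∪ (Vfs a ─ ⁅ v ⁆)) (VQ-ex v D a)

  Vars-all : ∀ v (a : Form n) → Vars (all v a) ≡ (VQ a ∪ ⁅ v ⁆) ∪ (Vfs a ─ ⁅ v ⁆)
  Vars-all v a = cong (_∪ (Vfs a ─ ⁅ v ⁆)) (VQ-all v a)

  evalM-cong : ∀ (φ : Form n) {ρ ρ' : Fin n → Bool} →
               (∀ {w} → w ∈ Vars φ → ρ w ≡ ρ' w) → evalM ρ φ ≡ evalM ρ' φ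
  evalM-cong (pos v) h = h (q⊆p∪q _ _ (x∈⁅x⁆ v))
  evalM-cong (neg v) h = cong not (h (q⊆p∪q _ _ (x∈⁅x⁆ v)))
  evalM-cong (and a b) h = cong₂ _∧_
    (evalM-cong a (h ∘ ⊆-reflexive (sym (Vars-and a b)) ∘ p⊆p∪q _))
    (evalM-cong b (h ∘ ⊆-reflexive (sym (Vars-and a b)) ∘ q⊆p∪q _ _))
  evalM-cong (or a b) h = cong₂ _∨_
    (evalM-cong a (h ∘ ⊆-reflexive (sym (Vars-or a b)) ∘ p⊆p∪q _))
    (evalM-cong b (h ∘ ⊆-reflexive (sym (Vars-or a b)) ∘ q⊆p∪q _ _))
  evalM-cong (ex v D a) h = evalM-cong a (h ∘ ⊆-reflexive (sym (Vars-ex v D a)) ∘ ∈-bind⁺)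
  evalM-cong (all v a) h = evalM-cong a (h ∘ ⊆-reflexive (sym (Vars-all v a)) ∘ ∈-bind⁺)

  Vex-removeDep : ∀ v (φ : Form n) → Vex (removeDep v φ) ≡ Vex φ
  Vex-removeDep v (pos w) = refl
  Vex-removeDep v (neg w) = refl
  Vex-removeDep v (and a b) = cong₂ _∪_ (Vex-removeDep v a) (Vex-removeDep v b)
  Vex-removeDep v (or a b) = cong₂ _∪_ (Vex-removeDep v a) (Vex-removeDep v b)
  Vex-removeDep v (ex w D a) = cong (_∪ ⁅ w ⁆) (Vex-removeDep v a)
  Vex-removeDep v (all w a) = Vex-removeDep v a

  Vall-removeDep : ∀ v (φ : Form n) → Vall (removeDep v φ) ≡ Vall φ
  Vall-removeDep v (pos w) = refl
  Vall-removeDep v (neg w) = refl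
  Vall-removeDep v (and a b) = cong₂ _∪_ (Vall-removeDep v a) (Vall-removeDep v b)
  Vall-removeDep v (or a b) = cong₂ _∪_ (Vall-removeDep v a) (Vall-removeDep v b)
  Vall-removeDep v (ex w D a) = Vall-removeDep v a
  Vall-removeDep v (all w a) = cong (_∪ ⁅ w ⁆) (Vall-removeDep v a)

  Vfs-removeDep : ∀ v (φ : Form n) → Vfs (removeDep v φ) ≡ Vfs φ
  Vfs-removeDep v (pos w) = refl
  Vfs-removeDep v (neg w) = refl
  Vfs-removeDep v (and a b) = cong₂ _∪_ (Vfs-removeDep v a) (Vfs-removeDep v b)
  Vfs-removeDep v (or a b) = cong₂ _∪_ (Vfs-removeDep v a) (Vfs-removeDep v b)
  Vfs-removeDep v (ex w D a) = cong (_─ ⁅ w ⁆) (Vfs-removeDep v a)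
  Vfs-removeDep v (all w a) = cong (_─ ⁅ w ⁆) (Vfs-removeDep v a)

  VQ-removeDep : ∀ v (φ : Form n) → VQ (removeDep v φ) ≡ VQ φ
  VQ-removeDep v φ = cong₂ _∪_ (Vex-removeDep v φ) (Vall-removeDep v φ)

  Vars-removeDep : ∀ v (φ : Form n) → Vars (removeDep v φ) ≡ Vars φ
  Vars-removeDep v φ = cong₂ _∪_ (VQ-removeDep v φ) (Vfs-removeDep v φ)

  Apart : Form n → Form n → Set
  Apart a b = ∀ {x} → x ∈ Vars a → x ∉ VQ b

  -- Well-formedness without the dependency-set conditions and without the removeDep of
  -- rule (5), so that it can be inverted along a context.
  data Rectified : Form n → Set where
    pos : ∀ v → Rectified (pos v)
    neg : ∀ v → Rectified (neg v)
    and : ∀ {a b} → Rectified a → Rectified b → Apart a b → Apart b a → Rectified (and a b)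
    or  : ∀ {a b} → Rectified a → Rectified b → Apart a b → Apart b a → Rectified (or a b)
    ex  : ∀ {a} v D → Rectified a → v ∉ VQ a → Rectified (ex v D a)
    all : ∀ {a} v → Rectified a → v ∉ VQ a → Rectified (all v a)

  Apart-removeDep : ∀ v {a b} → Apart a b → Apart (removeDep v a) (removeDep v b)
  Apart-removeDep v {a} {b} ap x∈a x∈b =
    ap (⊆-reflexive (Vars-removeDep v a) x∈a) (⊆-reflexive (VQ-removeDep v b) x∈b)

  Rectified-removeDep : ∀ v → Rectified φ → Rectified (removeDep v φ)
  Rectified-removeDep v (pos w) = pos w
  Rectified-removeDep v (neg w) = neg w
  Rectified-removeDep v (and {a} {b} ra rb ab ba) =
    and (Rectified-removeDep v ra) (Rectified-removeDep v rb)
       (Apart-removeDep v {a} {b} ab) (Apart-removeDep v {b} {a} ba)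
  Rectified-removeDep v (or {a} {b} ra rb ab ba) =
    or (Rectified-removeDep v ra) (Rectified-removeDep v rb)
       (Apart-removeDep v {a} {b} ab) (Apart-removeDep v {b} {a} ba)
  Rectified-removeDep v (ex {a} w D ra w∉a) =
    ex w _ (Rectified-removeDep v ra) (w∉a ∘ ⊆-reflexive (VQ-removeDep v a))
  Rectified-removeDep v (all {a} w ra w∉a) =
    all w (Rectified-removeDep v ra) (w∉a ∘ ⊆-reflexive (VQ-removeDep v a))

  Compat⇒Apart : ∀ {a b} → Compat a b → Apart a b
  Compat⇒Apart {a} c {x} x∈a x∈b with x∈p∪q⁻ (VQ a) (Vfs a) x∈a
  ... | inj₁ x∈Q = c (x , x∈p∩q⁺ (p⊆p∪q _ x∈Q , x∈b))
  ... | inj₂ x∈F = c (x , x∈p∩q⁺ (q⊆p∪q (VQ a) _ (p⊆p∪q _ x∈F) , x∈b))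

  WF⇒Rectified : WF φ → Rectified φ
  WF⇒Rectified (wf-pos v) = pos v
  WF⇒Rectified (wf-neg v) = neg v
  WF⇒Rectified (wf-and {a} {b} wa wb ab ba) =
    and (WF⇒Rectified wa) (WF⇒Rectified wb) (Compat⇒Apart {a} {b} ab) (Compat⇒Apart {b} {a} ba)
  WF⇒Rectified (wf-or {a} {b} wa wb ab ba) =
    or (WF⇒Rectified wa) (WF⇒Rectified wb) (Compat⇒Apart {a} {b} ab) (Compat⇒Apart {b} {a} ba)
  WF⇒Rectified (wf-ex {a} v D wa v∈free _) =
    ex v D (Rectified-removeDep v (WF⇒Rectified wa))
           (x∈∁p⇒x∉p v∈free ∘ ⊆-reflexive (VQ-removeDep v a))
  WF⇒Rectified (wf-all v wa v∈free) = all v (WF⇒Rectified wa) (x∈∁p⇒x∉p v∈free)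

  VQ-plug : ∀ (C : Ctx) → VQ χ ⊆ VQ (plug C χ)
  VQ-plug hole = ⊆-refl
  VQ-plug {χ} (andL C ρ) = ⊆-reflexive (sym (VQ-and (plug C χ) ρ)) ∘ p⊆p∪q _ ∘ VQ-plug C
  VQ-plug {χ} (andR ρ C) = ⊆-reflexive (sym (VQ-and ρ (plug C χ))) ∘ q⊆p∪q _ _ ∘ VQ-plug C
  VQ-plug {χ} (orL C ρ) = ⊆-reflexive (sym (VQ-or (plug C χ) ρ)) ∘ p⊆p∪q _ ∘ VQ-plug C
  VQ-plug {χ} (orR ρ C) = ⊆-reflexive (sym (VQ-or ρ (plug C χ))) ∘ q⊆p∪q _ _ ∘ VQ-plug C
  VQ-plug {χ} (exC v D C) = ⊆-reflexive (sym (VQ-ex v D (plug C χ))) ∘ p⊆p∪q _ ∘ VQ-plug C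
  VQ-plug {χ} (allC v C) = ⊆-reflexive (sym (VQ-all v (plug C χ))) ∘ p⊆p∪q _ ∘ VQ-plug C

  bound-in-hole⇒∈Vars-hole : ∀ (C : Ctx) → Rectified (plug C χ) →
                  x ∈ VQ χ → x ∈ Vars (plug C χ') → x ∈ Vars χ'
  bound-in-hole⇒∈Vars-hole hole _ _ x∈χ' = x∈χ'
  bound-in-hole⇒∈Vars-hole {χ' = χ'} (andL C ρ) (and rC _ _ ρ#C) x∈χ m
    with x∈p∪q⁻ _ _ (⊆-reflexive (Vars-and (plug C χ') ρ) m)
  ... | inj₁ m' = bound-in-hole⇒∈Vars-hole C rC x∈χ m'
  ... | inj₂ x∈ρ = ⊥-elim (ρ#C x∈ρ (VQ-plug C x∈χ))
  bound-in-hole⇒∈Vars-hole {χ' = χ'} (andR ρ C) (and _ rC ρ#C _) x∈χ m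
    with x∈p∪q⁻ _ _ (⊆-reflexive (Vars-and ρ (plug C χ')) m)
  ... | inj₁ x∈ρ = ⊥-elim (ρ#C x∈ρ (VQ-plug C x∈χ))
  ... | inj₂ m' = bound-in-hole⇒∈Vars-hole C rC x∈χ m'
  bound-in-hole⇒∈Vars-hole {χ' = χ'} (orL C ρ) (or rC _ _ ρ#C) x∈χ m
    with x∈p∪q⁻ _ _ (⊆-reflexive (Vars-or (plug C χ') ρ) m)
  ... | inj₁ m' = bound-in-hole⇒∈Vars-hole C rC x∈χ m'
  ... | inj₂ x∈ρ = ⊥-elim (ρ#C x∈ρ (VQ-plug C x∈χ))
  bound-in-hole⇒∈Vars-hole {χ' = χ'} (orR ρ C) (or _ rC ρ#C _) x∈χ m
    with x∈p∪q⁻ _ _ (⊆-reflexive (Vars-or ρ (plug C χ')) m)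
  ... | inj₁ x∈ρ = ⊥-elim (ρ#C x∈ρ (VQ-plug C x∈χ))
  ... | inj₂ m' = bound-in-hole⇒∈Vars-hole C rC x∈χ m'
  bound-in-hole⇒∈Vars-hole {χ' = χ'} (exC v D C) (ex _ _ rC v∉C) x∈χ m
    with ∈-bind⁻ (⊆-reflexive (Vars-ex v D (plug C χ')) m)
  ... | inj₁ refl = ⊥-elim (v∉C (VQ-plug C x∈χ))
  ... | inj₂ m' = bound-in-hole⇒∈Vars-hole C rC x∈χ m'
  bound-in-hole⇒∈Vars-hole {χ' = χ'} (allC v C) (all _ rC v∉C) x∈χ m
    with ∈-bind⁻ (⊆-reflexive (Vars-all v (plug C χ')) m)
  ... | inj₁ refl = ⊥-elim (v∉C (VQ-plug C x∈χ))
  ... | inj₂ m' = bound-in-hole⇒∈Vars-hole C rC x∈χ m'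

  Vall-plug : ∀ (C : Ctx) → Vall χ ≡ Vall χ' → Vall (plug C χ) ≡ Vall (plug C χ')
  Vall-plug hole e = e
  Vall-plug (andL C ρ) e = cong (_∪ Vall ρ) (Vall-plug C e)
  Vall-plug (andR ρ C) e = cong (Vall ρ ∪_) (Vall-plug C e)
  Vall-plug (orL C ρ) e = cong (_∪ Vall ρ) (Vall-plug C e)
  Vall-plug (orR ρ C) e = cong (Vall ρ ∪_) (Vall-plug C e)
  Vall-plug (exC v D C) e = Vall-plug C e
  Vall-plug (allC v C) e = cong (_∪ ⁅ v ⁆) (Vall-plug C e)

  evalM-plug : ∀ (C : Ctx) → (∀ ρ → evalM ρ χ ≡ evalM ρ χ') →
               ∀ ρ → evalM ρ (plug C χ) ≡ evalM ρ (plug C χ')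
  evalM-plug hole e ρ = e ρ
  evalM-plug (andL C r) e ρ = cong (_∧ evalM ρ r) (evalM-plug C e ρ)
  evalM-plug (andR r C) e ρ = cong (evalM ρ r ∧_) (evalM-plug C e ρ)
  evalM-plug (orL C r) e ρ = cong (_∨ evalM ρ r) (evalM-plug C e ρ)
  evalM-plug (orR r C) e ρ = cong (evalM ρ r ∨_) (evalM-plug C e ρ)
  evalM-plug (exC v D C) e ρ = evalM-plug C e ρ
  evalM-plug (allC v C) e ρ = evalM-plug C e ρ

  deps-plug : ∀ (C : Ctx) → deps χ x ≡ deps χ' x → deps (plug C χ) x ≡ deps (plug C χ') x
  deps-plug hole e = e
  deps-plug (andL C ρ) e = cong (_∪ deps ρ _) (deps-plug C e)
  deps-plug (andR ρ C) e = cong (deps ρ _ ∪_) (deps-plug C e)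
  deps-plug (orL C ρ) e = cong (_∪ deps ρ _) (deps-plug C e)
  deps-plug (orR ρ C) e = cong (deps ρ _ ∪_) (deps-plug C e)
  deps-plug {x = x} (exC v D C) e with x ≟ v
  ... | yes _ = refl
  ... | no _ = deps-plug C e
  deps-plug (allC v C) e = deps-plug C e

  ∪-mapˡ : ∀ {p p' : Subset n} r → (x ∈ p → x ∈ p') → x ∈ p ∪ r → x ∈ p' ∪ r
  ∪-mapˡ {p = p} r f h with x∈p∪q⁻ p r h
  ... | inj₁ x∈p = p⊆p∪q r (f x∈p)
  ... | inj₂ x∈r = q⊆p∪q _ r x∈r

  ∪-mapʳ : ∀ {p p' : Subset n} r → (x ∈ p → x ∈ p') → x ∈ r ∪ p → x ∈ r ∪ p'
  ∪-mapʳ {p = p} r f h with x∈p∪q⁻ r p h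
  ... | inj₁ x∈r = p⊆p∪q _ x∈r
  ... | inj₂ x∈p = q⊆p∪q r _ (f x∈p)

  Vex-plug-mono : ∀ (C : Ctx) → (x ∈ Vex χ → x ∈ Vex χ') →
                  x ∈ Vex (plug C χ) → x ∈ Vex (plug C χ')
  Vex-plug-mono hole f = f
  Vex-plug-mono (andL C ρ) f = ∪-mapˡ (Vex ρ) (Vex-plug-mono C f)
  Vex-plug-mono (andR ρ C) f = ∪-mapʳ (Vex ρ) (Vex-plug-mono C f)
  Vex-plug-mono (orL C ρ) f = ∪-mapˡ (Vex ρ) (Vex-plug-mono C f)
  Vex-plug-mono (orR ρ C) f = ∪-mapʳ (Vex ρ) (Vex-plug-mono C f)
  Vex-plug-mono (exC v D C) f = ∪-mapˡ ⁅ v ⁆ (Vex-plug-mono C f)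
  Vex-plug-mono (allC v C) f = Vex-plug-mono C f

  -- ψ' arises from ψ by deleting the quantifier ∃y, as seen by the semantics.
  record ExDrop (y : Fin n) (ψ ψ' : Form n) : Set where
    field
      Vall-≡  : Vall ψ ≡ Vall ψ'
      evalM-≡ : ∀ ρ → evalM ρ ψ ≡ evalM ρ ψ'
      Vex-⊇   : Vex ψ' ⊆ Vex ψ
      Vex-⊆   : x ≢ y → x ∈ Vex ψ → x ∈ Vex ψ'
      deps-≡  : x ≢ y → deps ψ x ≡ deps ψ' x

  ExDrop-ex : ∀ y D (φ : Form n) → ExDrop y (ex y D φ) φ
  ExDrop-ex y D φ = record
    { Vall-≡  = refl
    ; evalM-≡ = λ _ → refl
    ; Vex-⊇   = p⊆p∪q _
    ; Vex-⊆   = Vex-⊆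
    ; deps-≡  = deps-≡
    }
    where
    Vex-⊆ : x ≢ y → x ∈ Vex (ex y D φ) → x ∈ Vex φ
    Vex-⊆ x≢y h with x∈p∪q⁻ (Vex φ) _ h
    ... | inj₁ x∈φ = x∈φ
    ... | inj₂ x∈y = ⊥-elim (x≢y (x∈⁅y⁆⇒x≡y y x∈y))

    deps-≡ : x ≢ y → deps (ex y D φ) x ≡ deps φ x
    deps-≡ {x} x≢y with x ≟ y
    ... | yes x≡y = ⊥-elim (x≢y x≡y)
    ... | no _ = refl

  ExDrop-plug : ∀ {y} (C : Ctx) → ExDrop y χ χ' → ExDrop y (plug C χ) (plug C χ')
  ExDrop-plug C d = record
    { Vall-≡  = Vall-plug C Vall-≡
    ; evalM-≡ = evalM-plug C evalM-≡
    ; Vex-⊇   = Vex-plug-mono C Vex-⊇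
    ; Vex-⊆   = λ x≢y → Vex-plug-mono C (Vex-⊆ x≢y)
    ; deps-≡  = λ x≢y → deps-plug C (deps-≡ x≢y)
    }
    where open ExDrop d

  SuppIn-mono : ∀ {f : BoolFun {n}} {S T : Subset n} → S ⊆ T → SuppIn f S → SuppIn f T
  SuppIn-mono S⊆T f-S a b a≈b = f-S a b (λ w w∈S → a≈b w (S⊆T w∈S))

  pinFalse : Fin n → (Fin n → BoolFun {n}) → Fin n → BoolFun {n}
  pinFalse y s v with v ≟ y
  ... | yes _ = λ _ → false
  ... | no _ = s v

  pinFalse-≢ : ∀ {y} (s : Fin n → BoolFun {n}) → v ≢ y → pinFalse y s v ≡ s v
  pinFalse-≢ {v} {y} s v≢y with v ≟ y
  ... | yes v≡y = ⊥-elim (v≢y v≡y)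
  ... | no _ = refl

  pinFalse-SuppIn : ∀ {y} (s : Fin n → BoolFun {n}) S → (v ≢ y → SuppIn (s v) S) → SuppIn (pinFalse y s v) S
  pinFalse-SuppIn {v} {y} s S h with v ≟ y
  ... | yes _ = λ _ _ _ → refl
  ... | no v≢y = h v≢y

  module _ {y : Fin n} (d : ExDrop y ψ ψ') (y∉ψ' : y ∉ Vars ψ') where
    open ExDrop d

    VQ-⊇ : VQ ψ' ⊆ VQ ψ
    VQ-⊇ = ∪-mapʳ (Vex ψ) (⊆-reflexive (sym Vall-≡)) ∘ ∪-mapˡ (Vall ψ') Vex-⊇

    VQ-⊆ : x ≢ y → x ∈ VQ ψ → x ∈ VQ ψ'
    VQ-⊆ x≢y = ∪-mapʳ (Vex ψ') (⊆-reflexive Vall-≡) ∘ ∪-mapˡ (Vall ψ) (Vex-⊆ x≢y)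

    dependency-≡ : x ≢ y → deps ψ x ∩ Vall ψ ≡ deps ψ' x ∩ Vall ψ'
    dependency-≡ x≢y = cong₂ _∩_ (deps-≡ x≢y) Vall-≡

    evalM-valuation : ∀ s a → evalM (valuation ψ s a) ψ ≡ evalM (valuation ψ' s a) ψ'
    evalM-valuation s a =
      trans (cong (λ A → evalM (λ v → if lookup A v then a v else s v a) ψ) Vall-≡)
            (evalM-≡ _)

    InSem-ExDrop⁻ : ∀ {s} → InSem ψ' s → InSem ψ s
    InSem-ExDrop⁻ {s} ((free , exist) , valid) =
      (free' , exist') , λ a → trans (evalM-valuation s a) (valid a)
      where
      free' : ∀ v → v ∈ Vfree ψ → SuppIn (s v) ∅
      free' v v∈free = free v (p⊆q⇒∁p⊇∁q VQ-⊇ v∈free)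

      -- y, free in ψ', receives a constant, which is admissible for any dependency set.
      exist' : ∀ v → v ∈ Vex ψ → SuppIn (s v) (deps ψ v ∩ Vall ψ)
      exist' v v∈ψ with v ≟ y
      ... | yes refl = SuppIn-mono (⊆-min _) (free y (x∉p⇒x∈∁p (y∉ψ' ∘ p⊆p∪q _)))
      ... | no v≢y = subst (SuppIn (s v)) (sym (dependency-≡ v≢y)) (exist v (Vex-⊆ v≢y v∈ψ))

    InSem-ExDrop⁺ : ∀ {s} → InSem ψ s → InSem ψ' (pinFalse y s)
    InSem-ExDrop⁺ {s} ((free , exist) , valid) = (free' , exist') , valid'
      where
      free' : ∀ v → v ∈ Vfree ψ' → SuppIn (pinFalse y s v) ∅
      free' v v∈free = pinFalse-SuppIn s _ λ v≢y →
        free v (x∉p⇒x∈∁p (x∈∁p⇒x∉p v∈free ∘ VQ-⊆ v≢y))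

      exist' : ∀ v → v ∈ Vex ψ' → SuppIn (pinFalse y s v) (deps ψ' v ∩ Vall ψ')
      exist' v v∈ψ' = pinFalse-SuppIn s _ λ v≢y →
        subst (SuppIn (s v)) (dependency-≡ v≢y) (exist v (Vex-⊇ v∈ψ'))

      pinFalse-invisible : ∀ a {w} → w ∈ Vars ψ' →
                           valuation ψ' (pinFalse y s) a w ≡ valuation ψ' s a w
      pinFalse-invisible a {w} w∈ψ' =
        cong (λ f → if lookup (Vall ψ') w then a w else f a)
             (pinFalse-≢ s λ { refl → y∉ψ' w∈ψ' })

      valid' : ∀ a → evalM (valuation ψ' (pinFalse y s) a) ψ' ≡ true
      valid' a = begin
        evalM (valuation ψ' (pinFalse y s) a) ψ' ≡⟨ evalM-cong ψ' (pinFalse-invisible a) ⟩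
        evalM (valuation ψ' s a) ψ'              ≡⟨ sym (evalM-valuation s a) ⟩
        evalM (valuation ψ s a) ψ                ≡⟨ valid a ⟩
        true                                     ∎
        where open ≡-Reasoning

theorem5 : (n : ℕ) (C : Ctx {n}) (y : Fin n) (Dy : Subset n) (φ : Form n) →
           WF (plug C (ex y Dy φ)) →
           y ∉ Vars φ →
           Equisat (plug C (ex y Dy φ)) (plug C φ)
theorem5 n C y Dy φ wf y∉φ =
  mk⇔ (λ ψ-unsat (s , s∈ψ') → ψ-unsat (s , InSem-ExDrop⁻ drop y∉ψ' s∈ψ'))
      (λ ψ'-unsat (s , s∈ψ) → ψ'-unsat (_ , InSem-ExDrop⁺ drop y∉ψ' s∈ψ))
  where
  drop : ExDrop y (plug C (ex y Dy φ)) (plug C φ)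
  drop = ExDrop-plug C (ExDrop-ex y Dy φ)

  y∉ψ' : y ∉ Vars (plug C φ)
  y∉ψ' = y∉φ ∘ bound-in-hole⇒∈Vars-hole C (WF⇒Rectified wf)
                                          (p⊆p∪q _ (q⊆p∪q (Vex φ) _ (x∈⁅x⁆ y)))
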